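{- For powers of two $1\le k<n$, $H(n,k)\le A(n,k)$.
   Context: For a power of two $M$ let $O(M)=\frac M4(\log_2^2M-\log_2M+4)-1$. For powers of two $1\le k\le n$ let $B(n,k)=\frac14n\log_2^2k+\frac14n\log_2k+2n-\frac12k\log_2k-k-\frac nk$ (size of the bitonic selection network $bit\_sel^n_k$). Define $H(n,k)$ (size of the improved pairwise selection network $pw\_hbit\_sel^n_k$) by $H(n,1)=n-1$; $H(n,n)=O(n)$ for $n>1$; $H(n,k)=H(n/2,k)+H(n/2,k/2)+\frac n2+\frac{k\log_2k}{2}$ for $1<k<n$. Define $A(n,k)$ (size of the network $aux\_sel^n_k$ obtained from $pw\_hbit\_sel^n_k$ by replacing its recursive calls by bitonic selection networks) by $A(n,1)=n-1$ and $A(n,k)=B(n/2,k)+B(n/2,k/2)+\frac n2+\frac{k\log_2k}{2}$ for $1<k<n$. -}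

module Defs where

open import Data.Nat as ℕ using (ℕ; zero; suc; _^_; _∸_)
open import Data.Nat.Properties using (m^n≢0; _≟_)
open import Data.Integer using (+_)
open import Data.Rational using (ℚ; _+_; _-_; _*_; _/_; _≤_)
open import Relation.Nullary using (yes; no)

-- Powers of two are represented by their exponents: n = 2^a, k = 2^b,
-- so log₂ n = a and log₂ k = b.  All sizes are rational numbers.

ℕ→ℚ : ℕ → ℚ
ℕ→ℚ m = (+ m) / 1

pow2 : ℕ → ℚ
pow2 e = ℕ→ℚ (2 ^ e)

½ ¼ : ℚ
½ = + 1 / 2
¼ = + 1 / 4

O : ℕ → ℚ
O m = (pow2 m * ¼) * ((ℕ→ℚ m * ℕ→ℚ m - ℕ→ℚ m) + ℕ→ℚ 4) - ℕ→ℚ 1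

pow2-div : ℕ → ℕ → ℚ
pow2-div a b = (+ (2 ^ a)) / (2 ^ b)
  where instance _ = m^n≢0 2 b

B : ℕ → ℕ → ℚ
B a b = ¼ * n * (lk * lk) + ¼ * n * lk + ℕ→ℚ 2 * n
        - ½ * k * lk - k - pow2-div a b
  where
  n = pow2 a
  k = pow2 b
  lk = ℕ→ℚ b

-- H(n,k) for n = 2^a, k = 2^b (meaningful for b ≤ a)
H : ℕ → ℕ → ℚ
H a zero = pow2 a - ℕ→ℚ 1
H zero (suc b) = ℕ→ℚ 0                          -- k > n: outside the domain
H (suc a) (suc b) with suc b ≟ suc a
... | yes _ = O (suc a)
... | no _  = H a (suc b) + H a b + pow2 a
              + ½ * pow2 (suc b) * ℕ→ℚ (suc b)

-- A(n,k) for n = 2^a, k = 2^b (meaningful for b < a)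
A : ℕ → ℕ → ℚ
A a zero = pow2 a - ℕ→ℚ 1
A a (suc b) = B (a ∸ 1) (suc b) + B (a ∸ 1) b + pow2 (a ∸ 1)
              + ½ * pow2 (suc b) * ℕ→ℚ (suc b)

-- We show H(n,k) ≤ B(n,k) for all 1 ≤ k ≤ n by induction on n.  For k = 1 and
-- k = n both sides agree.  For 1 < k < n, H(n,k) is the pairwise recurrence applied to
-- H(n/2,k) and H(n/2,k/2), hence by induction at most the same recurrence applied to
-- B(n/2,k) and B(n/2,k/2), which is A(n,k); and with K = k/2, L = log₂ K, D = n/(2k),
--   B(n,k) − A(n,k) = D + K (D (L − 1) − L/2),
-- which is nonnegative because D ≥ 1.  Lemma 8 is then one unfolding of the recurrence.
module Submission where

open import Defs
open import Data.Nat as ℕ using (ℕ; zero; suc; _<_; s≤s)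
import Data.Nat.Properties as ℕ
open import Data.Integer as ℤ using (+_)
import Data.Integer.Properties as ℤ
open import Data.Product using (_,_)
open import Data.Rational using (ℚ; _+_; _-_; _*_; _/_; _≤_; 0ℚ; toℚᵘ; fromℚᵘ; nonNegative)
open import Data.Rational.Properties
  using ( ≤-refl; ≤-reflexive; +-mono-≤; +-monoˡ-≤; +-monoʳ-≤; +-identityʳ
        ; toℚᵘ-injective; toℚᵘ-fromℚᵘ; fromℚᵘ-cong; toℚᵘ-homo-+; toℚᵘ-homo-*
        ; normalize-nonNeg; nonNegative⁻¹; nonNeg*nonNeg⇒nonNeg; module ≤-Reasoning)
open import Data.Rational.Solver using (module +-*-Solver)
import Data.Rational.Unnormalised as ℚᵘ
import Data.Rational.Unnormalised.Properties as ℚᵘ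
open import Data.Sum using ([_,_])
open import Relation.Binary.PropositionalEquality using (_≡_; refl; sym; trans; cong; cong₂; subst)
open import Relation.Nullary using (yes; no)
open import Relation.Nullary.Negation using (contradiction)

fromℚᵘ-homo-+ : ∀ p q → fromℚᵘ (p ℚᵘ.+ q) ≡ fromℚᵘ p + fromℚᵘ q
fromℚᵘ-homo-+ p q = toℚᵘ-injective (begin
  toℚᵘ (fromℚᵘ (p ℚᵘ.+ q))                ≈⟨ toℚᵘ-fromℚᵘ (p ℚᵘ.+ q) ⟩
  p ℚᵘ.+ q                                ≈⟨ ℚᵘ.+-cong (toℚᵘ-fromℚᵘ p) (toℚᵘ-fromℚᵘ q) ⟨
  toℚᵘ (fromℚᵘ p) ℚᵘ.+ toℚᵘ (fromℚᵘ q)    ≈⟨ toℚᵘ-homo-+ (fromℚᵘ p) (fromℚᵘ q) ⟨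
  toℚᵘ (fromℚᵘ p + fromℚᵘ q)              ∎)
  where open ℚᵘ.≃-Reasoning

fromℚᵘ-homo-* : ∀ p q → fromℚᵘ (p ℚᵘ.* q) ≡ fromℚᵘ p * fromℚᵘ q
fromℚᵘ-homo-* p q = toℚᵘ-injective (begin
  toℚᵘ (fromℚᵘ (p ℚᵘ.* q))                ≈⟨ toℚᵘ-fromℚᵘ (p ℚᵘ.* q) ⟩
  p ℚᵘ.* q                                ≈⟨ ℚᵘ.*-cong (toℚᵘ-fromℚᵘ p) (toℚᵘ-fromℚᵘ q) ⟨
  toℚᵘ (fromℚᵘ p) ℚᵘ.* toℚᵘ (fromℚᵘ q)    ≈⟨ toℚᵘ-homo-* (fromℚᵘ p) (fromℚᵘ q) ⟨
  toℚᵘ (fromℚᵘ p * fromℚᵘ q)              ∎)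
  where open ℚᵘ.≃-Reasoning

-- ℕ→ℚ m is definitionally fromℚᵘ (ℕ→ℚᵘ m).
ℕ→ℚᵘ : ℕ → ℚᵘ.ℚᵘ
ℕ→ℚᵘ m = ℚᵘ.mkℚᵘ (+ m) 0

ℕ→ℚ-homo-+ : ∀ m n → ℕ→ℚ (m ℕ.+ n) ≡ ℕ→ℚ m + ℕ→ℚ n
ℕ→ℚ-homo-+ m n =
  trans (fromℚᵘ-cong {ℕ→ℚᵘ (m ℕ.+ n)} {ℕ→ℚᵘ m ℚᵘ.+ ℕ→ℚᵘ n} (ℚᵘ.*≡* (cong (ℤ._* + 1) +[m+n]≡m*1+n*1)))
        (fromℚᵘ-homo-+ (ℕ→ℚᵘ m) (ℕ→ℚᵘ n))
  where
  +[m+n]≡m*1+n*1 : + (m ℕ.+ n) ≡ + m ℤ.* + 1 ℤ.+ + n ℤ.* + 1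
  +[m+n]≡m*1+n*1 =
    trans (ℤ.pos-+ m n) (sym (cong₂ ℤ._+_ (ℤ.*-identityʳ (+ m)) (ℤ.*-identityʳ (+ n))))

ℕ→ℚ-homo-* : ∀ m n → ℕ→ℚ (m ℕ.* n) ≡ ℕ→ℚ m * ℕ→ℚ n
ℕ→ℚ-homo-* m n =
  trans (fromℚᵘ-cong {ℕ→ℚᵘ (m ℕ.* n)} {ℕ→ℚᵘ m ℚᵘ.* ℕ→ℚᵘ n} (ℚᵘ.*≡* (cong (ℤ._* + 1) (ℤ.pos-* m n))))
        (fromℚᵘ-homo-* (ℕ→ℚᵘ m) (ℕ→ℚᵘ n))

ℕ→ℚ-suc : ∀ m → ℕ→ℚ (suc m) ≡ ℕ→ℚ 1 + ℕ→ℚ m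
ℕ→ℚ-suc = ℕ→ℚ-homo-+ 1

ℕ→ℚ-nonNeg : ∀ m → 0ℚ ≤ ℕ→ℚ m
ℕ→ℚ-nonNeg m = nonNegative⁻¹ (ℕ→ℚ m) {{normalize-nonNeg m 1}}

+[m*n]/n≡ℕ→ℚm : ∀ m n .{{_ : ℕ.NonZero n}} → (+ (m ℕ.* n)) / n ≡ ℕ→ℚ m
+[m*n]/n≡ℕ→ℚm m (suc n) = fromℚᵘ-cong {ℚᵘ.mkℚᵘ (+ (m ℕ.* suc n)) n} {ℕ→ℚᵘ m}
                            (ℚᵘ.*≡* (trans (ℤ.*-identityʳ _) (ℤ.pos-* m (suc n))))

pow2-suc : ∀ m → pow2 (suc m) ≡ ℕ→ℚ 2 * pow2 m
pow2-suc m = ℕ→ℚ-homo-* 2 (2 ℕ.^ m)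

pow2-+ : ∀ m n → pow2 (m ℕ.+ n) ≡ pow2 m * pow2 n
pow2-+ m n = trans (cong ℕ→ℚ (ℕ.^-distribˡ-+-* 2 m n)) (ℕ→ℚ-homo-* (2 ℕ.^ m) (2 ℕ.^ n))

pow2≡1+pred : ∀ m → pow2 m ≡ ℕ→ℚ 1 + ℕ→ℚ (ℕ.pred (2 ℕ.^ m))
pow2≡1+pred m = trans (cong ℕ→ℚ (sym (ℕ.suc-pred (2 ℕ.^ m) {{ℕ.m^n≢0 2 m}})))
                      (ℕ→ℚ-homo-+ 1 (ℕ.pred (2 ℕ.^ m)))

pow2-div-+ : ∀ m n → pow2-div (m ℕ.+ n) m ≡ pow2 n
pow2-div-+ m n =
  trans (cong (λ x → + x / 2 ℕ.^ m) 2^[m+n]≡2^n*2^m) (+[m*n]/n≡ℕ→ℚm (2 ℕ.^ n) (2 ℕ.^ m))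
  where
  instance _ = ℕ.m^n≢0 2 m
  2^[m+n]≡2^n*2^m : 2 ℕ.^ (m ℕ.+ n) ≡ 2 ℕ.^ n ℕ.* 2 ℕ.^ m
  2^[m+n]≡2^n*2^m = trans (ℕ.^-distribˡ-+-* 2 m n) (ℕ.*-comm (2 ℕ.^ m) (2 ℕ.^ n))

0≤+ : ∀ {p q} → 0ℚ ≤ p → 0ℚ ≤ q → 0ℚ ≤ p + q
0≤+ = +-mono-≤

0≤* : ∀ {p q} → 0ℚ ≤ p → 0ℚ ≤ q → 0ℚ ≤ p * q
0≤* {p} {q} 0≤p 0≤q =
  nonNegative⁻¹ (p * q) {{nonNeg*nonNeg⇒nonNeg p {{nonNegative 0≤p}} q {{nonNegative 0≤q}}}}

p≤p+q : ∀ p {q} → 0ℚ ≤ q → p ≤ p + q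
p≤p+q p 0≤q = subst (_≤ p + _) (+-identityʳ p) (+-monoʳ-≤ p 0≤q)

-- B(n,k) with N = n, K = k, L = log₂ k, D = n/k;
-- definitionally B a b ≡ bitSel (pow2 a) (pow2 b) (ℕ→ℚ b) (pow2-div a b).
bitSel : (N K L D : ℚ) → ℚ
bitSel N K L D = ¼ * N * (L * L) + ¼ * N * L + ℕ→ℚ 2 * N - ½ * K * L - K - D

-- B(n,k) − A(n,k) for k = 2K, L = log₂ K, n = 4KD.
slack : (K L D : ℚ) → ℚ
slack K L D = D + K * (D * (L - ℕ→ℚ 1) - ½ * L)

module Identities where
  open +-*-Solver

  κ : ∀ {m} → ℕ → Polynomial m
  κ m = con (ℕ→ℚ m)

  bitSelᴾ : ∀ {m} (N K L D : Polynomial m) → Polynomial m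
  bitSelᴾ N K L D =
    con ¼ :* N :* (L :* L) :+ con ¼ :* N :* L :+ κ 2 :* N :- con ½ :* K :* L :- K :- D

  slackᴾ : ∀ {m} (K L D : Polynomial m) → Polynomial m
  slackᴾ K L D = D :+ K :* (D :* (L :- κ 1) :- con ½ :* L)

  bitSel-split : ∀ {K L D P Q L′} → P ≡ ℕ→ℚ 2 * K → Q ≡ ℕ→ℚ 2 * D → L′ ≡ ℕ→ℚ 1 + L →
    bitSel (P * Q) P L′ Q
    ≡ bitSel (P * D) P L′ D + bitSel (K * Q) K L Q + P * D + ½ * P * L′ + slack K L D
  bitSel-split {K} {L} {D} refl refl refl = solve 3 (λ K L D →
    bitSelᴾ (κ 2 :* K :* (κ 2 :* D)) (κ 2 :* K) (κ 1 :+ L) (κ 2 :* D)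
    := bitSelᴾ (κ 2 :* K :* D) (κ 2 :* K) (κ 1 :+ L) D :+ bitSelᴾ (K :* (κ 2 :* D)) K L (κ 2 :* D)
       :+ κ 2 :* K :* D :+ con ½ :* (κ 2 :* K) :* (κ 1 :+ L) :+ slackᴾ K L D) refl K L D

  bitSel-one : ∀ N → N - ℕ→ℚ 1 ≡ bitSel N (ℕ→ℚ 1) (ℕ→ℚ 0) N
  bitSel-one = solve 1 (λ N → N :- κ 1 := bitSelᴾ N (κ 1) (κ 0) N) refl

  bitSel-diagonal : ∀ N L → N * ¼ * (L * L - L + ℕ→ℚ 4) - ℕ→ℚ 1 ≡ bitSel N N L (ℕ→ℚ 1)
  bitSel-diagonal =
    solve 2 (λ N L → N :* con ¼ :* (L :* L :- L :+ κ 4) :- κ 1 := bitSelᴾ N N L (κ 1)) refl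

  slack-zero : ∀ D → slack (ℕ→ℚ 1) (ℕ→ℚ 0) D ≡ 0ℚ
  slack-zero = solve 1 (λ D → slackᴾ (κ 1) (κ 0) D := κ 0) refl

  slack-one : ∀ {D} F → D ≡ ℕ→ℚ 1 + F → slack (ℕ→ℚ 2) (ℕ→ℚ 1) D ≡ F
  slack-one F refl = solve 1 (λ F → slackᴾ (κ 2) (κ 1) (κ 1 :+ F) := F) refl F

  slack-≥2 : ∀ {K L D} J E F → K ≡ ℕ→ℚ 2 * (ℕ→ℚ 2 * J) → L ≡ ℕ→ℚ 1 + (ℕ→ℚ 1 + E) → D ≡ ℕ→ℚ 1 + F →
             slack K L D ≡ ℕ→ℚ 1 + F + ℕ→ℚ 2 * J * (ℕ→ℚ 2 * F * (ℕ→ℚ 1 + E) + E)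
  slack-≥2 J E F refl refl refl = solve 3 (λ J E F →
    slackᴾ (κ 2 :* (κ 2 :* J)) (κ 1 :+ (κ 1 :+ E)) (κ 1 :+ F)
    := κ 1 :+ F :+ κ 2 :* J :* (κ 2 :* F :* (κ 1 :+ E) :+ E)) refl J E F

open Identities using (bitSel-split; bitSel-one; bitSel-diagonal; slack-zero; slack-one; slack-≥2)

slack-nonNeg : ∀ b d → 0ℚ ≤ slack (pow2 b) (ℕ→ℚ b) (pow2 d)
slack-nonNeg zero d = ≤-reflexive (sym (slack-zero (pow2 d)))
slack-nonNeg (suc zero) d =
  subst (0ℚ ≤_) (sym (slack-one F (pow2≡1+pred d))) (ℕ→ℚ-nonNeg (ℕ.pred (2 ℕ.^ d)))
  where F = ℕ→ℚ (ℕ.pred (2 ℕ.^ d))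
slack-nonNeg (suc (suc e)) d =
  subst (0ℚ ≤_) (sym (slack-≥2 J E F K≡4J L≡2+E (pow2≡1+pred d)))
    (0≤+ (0≤+ (ℕ→ℚ-nonNeg 1) F≥0)
         (0≤* (0≤* (ℕ→ℚ-nonNeg 2) (ℕ→ℚ-nonNeg (2 ℕ.^ e)))
              (0≤+ (0≤* (0≤* (ℕ→ℚ-nonNeg 2) F≥0) (0≤+ (ℕ→ℚ-nonNeg 1) (ℕ→ℚ-nonNeg e)))
                   (ℕ→ℚ-nonNeg e))))
  where
  J = pow2 e
  E = ℕ→ℚ e
  F = ℕ→ℚ (ℕ.pred (2 ℕ.^ d))
  F≥0 = ℕ→ℚ-nonNeg (ℕ.pred (2 ℕ.^ d))
  K≡4J : pow2 (suc (suc e)) ≡ ℕ→ℚ 2 * (ℕ→ℚ 2 * J)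
  K≡4J = trans (pow2-suc (suc e)) (cong (ℕ→ℚ 2 *_) (pow2-suc e))
  L≡2+E : ℕ→ℚ (suc (suc e)) ≡ ℕ→ℚ 1 + (ℕ→ℚ 1 + E)
  L≡2+E = trans (ℕ→ℚ-suc (suc e)) (cong (_+_ (ℕ→ℚ 1)) (ℕ→ℚ-suc e))

B≡bitSel : ∀ {a} b d → b ℕ.+ d ≡ a → B a b ≡ bitSel (pow2 b * pow2 d) (pow2 b) (ℕ→ℚ b) (pow2 d)
B≡bitSel b d refl = cong₂ (λ N D → bitSel N (pow2 b) (ℕ→ℚ b) D) (pow2-+ b d) (pow2-div-+ b d)

B-one : ∀ a → B a 0 ≡ pow2 a - ℕ→ℚ 1
B-one a =
  trans (cong (bitSel (pow2 a) (ℕ→ℚ 1) (ℕ→ℚ 0)) (pow2-div-+ 0 a)) (sym (bitSel-one (pow2 a)))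

B-diagonal : ∀ a → B a a ≡ O a
B-diagonal a = trans (cong (bitSel (pow2 a) (pow2 a) (ℕ→ℚ a)) pow2-div-self)
                     (sym (bitSel-diagonal (pow2 a) (ℕ→ℚ a)))
  where
  pow2-div-self : pow2-div a a ≡ ℕ→ℚ 1
  pow2-div-self = trans (cong (λ x → pow2-div x a) (sym (ℕ.+-identityʳ a))) (pow2-div-+ a 0)

-- The pairwise recurrence for n = 2^(a+1), k = 2^(b+1) with recursive parts of sizes s and t;
-- definitionally A (suc a) (suc b) ≡ pwSize (B a (suc b)) (B a b) a b.
pwSize : (s t : ℚ) (a b : ℕ) → ℚ
pwSize s t a b = s + t + pow2 a + ½ * pow2 (suc b) * ℕ→ℚ (suc b)

pwSize-mono-≤ : ∀ {s s′ t t′} a b → s ≤ s′ → t ≤ t′ → pwSize s t a b ≤ pwSize s′ t′ a b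
pwSize-mono-≤ a b s≤s′ t≤t′ = +-monoˡ-≤ _ (+-monoˡ-≤ (pow2 a) (+-mono-≤ s≤s′ t≤t′))

A≤B-offset : ∀ b d → A (suc (suc b ℕ.+ d)) (suc b) ≤ B (suc (suc b ℕ.+ d)) (suc b)
A≤B-offset b d = begin
  A (suc (suc b ℕ.+ d)) (suc b)
    ≡⟨ cong (_+ ½ * P * L′) (cong₂ _+_ (cong₂ _+_ (B≡bitSel (suc b) d refl)
                                                  (B≡bitSel b (suc d) (ℕ.+-suc b d)))
                                       (pow2-+ (suc b) d)) ⟩
  bitSel (P * D) P L′ D + bitSel (K * Q) K L Q + P * D + ½ * P * L′
    ≤⟨ p≤p+q _ (slack-nonNeg b d) ⟩
  bitSel (P * D) P L′ D + bitSel (K * Q) K L Q + P * D + ½ * P * L′ + slack K L D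
    ≡⟨ bitSel-split {K} {L} {D} (pow2-suc b) (pow2-suc d) (ℕ→ℚ-suc b) ⟨
  bitSel (P * Q) P L′ Q
    ≡⟨ B≡bitSel (suc b) (suc d) (cong suc (ℕ.+-suc b d)) ⟨
  B (suc (suc b ℕ.+ d)) (suc b) ∎
  where
  open ≤-Reasoning
  K = pow2 b; L = ℕ→ℚ b; D = pow2 d; P = pow2 (suc b); Q = pow2 (suc d); L′ = ℕ→ℚ (suc b)

A≤B : ∀ {a b} → b < a → A (suc a) (suc b) ≤ B (suc a) (suc b)
A≤B {b = b} b<a =
  let d , 1+b+d≡a = ℕ.m≤n⇒∃[o]m+o≡n b<a in
  subst (λ a → A (suc a) (suc b) ≤ B (suc a) (suc b)) 1+b+d≡a (A≤B-offset b d)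

H-suc : ∀ {a b} → b < a → H (suc a) (suc b) ≡ pwSize (H a (suc b)) (H a b) a b
H-suc {a} {b} b<a with suc b ℕ.≟ suc a
... | yes b≡a = contradiction (ℕ.suc-injective b≡a) (ℕ.<⇒≢ b<a)
... | no _    = refl

H-diagonal : ∀ a → H (suc a) (suc a) ≡ O (suc a)
H-diagonal a with suc a ℕ.≟ suc a
... | yes _   = refl
... | no a≢a  = contradiction refl a≢a

H≤B : ∀ {a b} → b ℕ.≤ a → H a b ≤ B a b
H≤B {a} {zero} _ = ≤-reflexive (sym (B-one a))
H≤B {suc a} {suc b} (s≤s b≤a) = [ H≤B-below , H≤B-diagonal ] (ℕ.m≤n⇒m<n∨m≡n b≤a)
  where
  open ≤-Reasoning
  H≤B-below : b < a → H (suc a) (suc b) ≤ B (suc a) (suc b)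
  H≤B-below b<a = begin
    H (suc a) (suc b)                     ≡⟨ H-suc b<a ⟩
    pwSize (H a (suc b)) (H a b) a b      ≤⟨ pwSize-mono-≤ a b (H≤B b<a) (H≤B b≤a) ⟩
    A (suc a) (suc b)                     ≤⟨ A≤B b<a ⟩
    B (suc a) (suc b)                     ∎
  H≤B-diagonal : b ≡ a → H (suc a) (suc b) ≤ B (suc a) (suc b)
  H≤B-diagonal refl = ≤-reflexive (trans (H-diagonal a) (sym (B-diagonal (suc a))))

lemma8 : (a b : ℕ) → b < a → H a b ≤ A a b
lemma8 a zero _ = ≤-refl
lemma8 (suc a) (suc b) (s≤s b<a) = begin
  H (suc a) (suc b)                     ≡⟨ H-suc b<a ⟩
  pwSize (H a (suc b)) (H a b) a b      ≤⟨ pwSize-mono-≤ a b (H≤B b<a) (H≤B (ℕ.<⇒≤ b<a)) ⟩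
  A (suc a) (suc b)                     ∎
  where open ≤-Reasoning
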